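{- The 2-color Rado number of $x_1+x_2+x_3=5x_4$ is $9$; that is, $R_2(4,5)=9$.
   Context: The 2-color Rado number of $x_1+\cdots+x_{m-1}=ax_m$ is the least positive integer $n$ such that for every coloring of $[n]=\{1,\dots,n\}$ with two colors there exist $x_1,\dots,x_m\in[n]$ (not necessarily distinct), all of the same color, satisfying the equation. -}

module Defs where

open import Data.Nat using (ℕ; suc; _+_; _*_; _≤_; _<_)
open import Data.Bool using (Bool)
open import Data.Fin using (Fin)
open import Data.Vec.Functional using (Vector; foldr)
open import Data.Product using (Σ; _×_; ∃)
open import Relation.Binary.PropositionalEquality using (_≡_)
open import Relation.Nullary using (¬_)
open import Data.Empty using (⊥)

InRange : ℕ → ℕ → Set
InRange n x = 1 ≤ x × x ≤ n

-- A 2-coloring of [n]: a map to Bool (values outside [n] are irrelevant,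
-- since only elements of [n] are ever inspected).
Coloring : Set
Coloring = ℕ → Bool

vsum : ∀ {k} → Vector ℕ k → ℕ
vsum = foldr _+_ 0

-- Monochromatic solution in [n] of x₁+⋯+x_{m-1} = a·x_m, with k = m-1
-- left-hand variables xs and right-hand variable y (not necessarily distinct).
MonoSolution : (k a n : ℕ) → Coloring → Set
MonoSolution k a n c =
  Σ (Vector ℕ k) λ xs → Σ ℕ λ y →
    (∀ i → InRange n (xs i)) × InRange n y ×
    (∀ i → c (xs i) ≡ c y) ×
    vsum xs ≡ a * y

Forces : (k a n : ℕ) → Set
Forces k a n = (c : Coloring) → MonoSolution k a n c

RadoNumber2 : (m a r : ℕ) → Set
RadoNumber2 (suc k) a r = 1 ≤ r × Forces k a r × (∀ n → 1 ≤ n → n < r → ¬ Forces k a n)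
RadoNumber2 0 a r = ⊥

module Submission where

-- R₂(4,5) = 9: every 2-coloring of [9] has a monochromatic solution of
-- x₁ + x₂ + x₃ = 5y, and the coloring {1,4,5,6} ∪ {2,3,7,8} of [8] has none.
--
-- Both facts are finite, so we prove them by verified decision procedures,
-- developed for the general equation x₁ + ⋯ + x_k = a·y on [n]:
--   * a sum s is a sum of k elements of [n] of a given color iff (k = 0 and
--     s = 0) or some x ∈ [n] of that color with x ≤ s leaves s ∸ x as such a
--     sum of k - 1 elements; hence representability is decidable (the bound
--     s ≤ k·n prunes the search), and so is the existence of a monochromatic
--     solution (search over y ∈ [n]);
--   * existence of a solution depends only on the coloring of [n], and any
--     property of colorings with that locality can be decided for all
--     colorings at once by branching on the colors of n, n - 1, …, 1;
--     hence "every 2-coloring of [n] is forced" is decidable;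
--   * solutions in [m] are solutions in [n] for m ≤ n, so the single
--     coloring of [8] rules out every n ≤ 8.
-- The theorem then follows by running the two decision procedures.

open import Defs
open import Data.Nat using (ℕ; zero; suc; _+_; _∸_; _*_; _≤_; _<_; z≤n; s≤s; _≟_; _≤?_)
open import Data.Nat.Properties using (≤-trans; ≤-reflexive; +-mono-≤; ≤-pred; ≤∧≢⇒<; m≤m+n; m+n∸m≡n; m+[n∸m]≡n; anyUpTo?)
open import Data.Bool using (Bool; true; false)
import Data.Bool.Properties as Bool
open import Data.Fin using (zero; suc)
open import Data.Vec.Functional using (Vector; []; _∷_)
open import Data.Product using (Σ; ∃; _×_; _,_; proj₁; proj₂)
open import Relation.Binary.PropositionalEquality using (_≡_; refl; sym; trans; cong; subst)
open import Relation.Nullary using (¬_; Dec; yes; no)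
open import Relation.Nullary.Decidable using (map′; _×-dec_; from-yes; from-no)

any-in? : ∀ n {P : ℕ → Set} → (∀ x → Dec (P x)) → Dec (∃ λ x → InRange n x × P x)
any-in? n {P} P? = map′ shift unshift (anyUpTo? (λ m → P? (suc m)) n)
  where
  shift : (∃ λ m → m < n × P (suc m)) → ∃ λ x → InRange n x × P x
  shift (m , m<n , p) = suc m , (s≤s z≤n , m<n) , p
  unshift : (∃ λ x → InRange n x × P x) → ∃ λ m → m < n × P (suc m)
  unshift (suc m , (_ , m<n) , p) = m , m<n , p

Representation : (k n : ℕ) → Coloring → Bool → ℕ → Set
Representation k n c b s =
  Σ (Vector ℕ k) λ xs →
    (∀ i → InRange n (xs i)) × (∀ i → c (xs i) ≡ b) × vsum xs ≡ s

all-∷ : ∀ {k} (P : ℕ → Set) {x} {xs : Vector ℕ k} →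
        P x → (∀ i → P (xs i)) → ∀ i → P ((x ∷ xs) i)
all-∷ P px pxs zero    = px
all-∷ P px pxs (suc i) = pxs i

representation-zero : ∀ {n c b s} → Representation 0 n c b s → s ≡ 0
representation-zero (_ , _ , _ , sum≡s) = sym sum≡s

FirstSummand : (k n : ℕ) → Coloring → Bool → ℕ → Set
FirstSummand k n c b s =
  ∃ λ x → InRange n x × (c x ≡ b × x ≤ s) × Representation k n c b (s ∸ x)

representation-∷ : ∀ {k n c b s} → FirstSummand k n c b s → Representation (suc k) n c b s
representation-∷ {c = c} {b} (x , x∈[n] , (cx≡b , x≤s) , xs , xs∈[n] , cxs≡b , sum≡s∸x) =
  x ∷ xs , all-∷ (InRange _) x∈[n] xs∈[n] , all-∷ (λ z → c z ≡ b) cx≡b cxs≡b ,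
  trans (cong (x +_) sum≡s∸x) (m+[n∸m]≡n x≤s)

representation-head : ∀ {k n c b s} → Representation (suc k) n c b s → FirstSummand k n c b s
representation-head {s = s} (xs , xs∈[n] , cxs≡b , sum≡s) =
  xs zero , xs∈[n] zero , (cxs≡b zero , x≤s) ,
  (λ i → xs (suc i)) , (λ i → xs∈[n] (suc i)) , (λ i → cxs≡b (suc i)) , rest≡s∸x
  where
  x≤s : xs zero ≤ s
  x≤s = subst (xs zero ≤_) sum≡s (m≤m+n (xs zero) _)
  rest≡s∸x : vsum (λ i → xs (suc i)) ≡ s ∸ xs zero
  rest≡s∸x = trans (sym (m+n∸m≡n (xs zero) _)) (cong (_∸ xs zero) sum≡s)

representation-bound : ∀ k {n c b s} → Representation k n c b s → s ≤ k * n
representation-bound zero    {c = c} r = ≤-reflexive (representation-zero {c = c} r)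
representation-bound (suc k) {n} {c} r with representation-head {c = c} r
... | x , (_ , x≤n) , (_ , x≤s) , rest =
  subst (_≤ suc k * n) (m+[n∸m]≡n x≤s) (+-mono-≤ x≤n (representation-bound k {c = c} rest))

representation? : ∀ k n c b s → Dec (Representation k n c b s)
representation? zero    n c b s =
  map′ (λ { refl → [] , (λ ()) , (λ ()) , refl }) (representation-zero {c = c}) (s ≟ 0)
representation? (suc k) n c b s with s ≤? suc k * n
... | no  s≰bound = no λ r → s≰bound (representation-bound (suc k) {c = c} r)
... | yes _       =
  map′ representation-∷ (representation-head {c = c})
       (any-in? n λ x → (c x Bool.≟ b ×-dec x ≤? s) ×-dec representation? k n c b (s ∸ x))

mono? : ∀ k a n c → Dec (MonoSolution k a n c)
mono? k a n c =
  map′ (λ (y , y∈[n] , (xs , xs∈[n] , cxs≡cy , sum≡ay)) → xs , y , xs∈[n] , y∈[n] , cxs≡cy , sum≡ay)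
       (λ (xs , y , xs∈[n] , y∈[n] , cxs≡cy , sum≡ay) → y , y∈[n] , (xs , xs∈[n] , cxs≡cy , sum≡ay))
       (any-in? n λ y → representation? k n c (c y) (a * y))

mono-enlarge : ∀ {k a m n c} → m ≤ n → MonoSolution k a m c → MonoSolution k a n c
mono-enlarge m≤n (xs , y , xs∈[m] , (1≤y , y≤m) , cxs≡cy , sum≡ay) =
  xs , y , (λ i → proj₁ (xs∈[m] i) , ≤-trans (proj₂ (xs∈[m] i)) m≤n) ,
  (1≤y , ≤-trans y≤m m≤n) , cxs≡cy , sum≡ay

_≗[_]_ : Coloring → ℕ → Coloring → Set
c ≗[ n ] c′ = ∀ x → InRange n x → c x ≡ c′ x

Local : ℕ → (Coloring → Set) → Set
Local n P = ∀ {c c′} → c ≗[ n ] c′ → P c → P c′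

mono-local : ∀ k a n → Local n (MonoSolution k a n)
mono-local k a n c≗c′ (xs , y , xs∈[n] , y∈[n] , cxs≡cy , sum≡ay) =
  xs , y , xs∈[n] , y∈[n] ,
  (λ i → trans (sym (c≗c′ (xs i) (xs∈[n] i))) (trans (cxs≡cy i) (c≗c′ y y∈[n]))) ,
  sum≡ay

recolor : Coloring → ℕ → Bool → Coloring
recolor c m b x with x ≟ m
... | yes _ = b
... | no  _ = c x

recolor-self : ∀ c m x → recolor c m (c m) x ≡ c x
recolor-self c m x with x ≟ m
... | yes refl = refl
... | no  _    = refl

recolor-agree : ∀ {c c′ n} b → c ≗[ n ] c′ → recolor c (suc n) b ≗[ suc n ] recolor c′ (suc n) b
recolor-agree {n = n} b c≗c′ x (1≤x , x≤1+n) with x ≟ suc n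
... | yes _   = refl
... | no  x≢1+n = c≗c′ x (1≤x , ≤-pred (≤∧≢⇒< x≤1+n x≢1+n))

-- A decidable property depending only on the colors of [n] can be decided for
-- all colorings: for n = 0 test one coloring; otherwise require it for both
-- recolorings of n, a property depending only on [n - 1], and recurse.
all-colorings? : ∀ n {P : Coloring → Set} → Local n P → (∀ c → Dec (P c)) → Dec (∀ c → P c)
all-colorings? zero    local P? with P? (λ _ → false)
... | yes p  = yes λ c → local (λ { _ (s≤s _ , ()) }) p
... | no  ¬p = no λ all → ¬p (all _)
all-colorings? (suc n) {P} local P? =
  map′ every (λ all c → all _ , all _)
       (all-colorings? n both-local λ c → P? (recolor c (suc n) false) ×-dec P? (recolor c (suc n) true))
  where
  Both : Coloring → Set
  Both c = P (recolor c (suc n) false) × P (recolor c (suc n) true)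
  both-local : Local n Both
  both-local c≗c′ (p , q) = local (recolor-agree false c≗c′) p , local (recolor-agree true c≗c′) q
  pick : ∀ {c} b → Both c → P (recolor c (suc n) b)
  pick false = proj₁
  pick true  = proj₂
  every : (∀ c → Both c) → ∀ c → P c
  every all c = local (λ x _ → recolor-self c (suc n) x) (pick (c (suc n)) (all c))

forces? : ∀ k a n → Dec (Forces k a n)
forces? k a n = all-colorings? n (mono-local k a n) (mono? k a n)

avoiding8 : Coloring
avoiding8 2 = true
avoiding8 3 = true
avoiding8 7 = true
avoiding8 8 = true
avoiding8 _ = false

-- [9] is forced (decided over all 512 colorings), and for n ≤ 8 a solution in
-- [n] for avoiding8 would be one in [8], which the decision procedure refutes.
lemma9 : RadoNumber2 4 5 9
lemma9 = s≤s z≤n , from-yes (forces? 3 5 9) , below9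
  where
  no-solution-in-[8] : ¬ MonoSolution 3 5 8 avoiding8
  no-solution-in-[8] = from-no (mono? 3 5 8 avoiding8)
  below9 : ∀ n → 1 ≤ n → n < 9 → ¬ Forces 3 5 n
  below9 n _ n<9 forces =
    no-solution-in-[8] (mono-enlarge {k = 3} {a = 5} {c = avoiding8} (≤-pred n<9) (forces avoiding8))
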